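{- Let $\ell\ge1$ and consider the line with sites $0,1,\dots,2^\ell$ and the input sequence consisting of $N\ge1$ phases as described in the context, with the server starting at site $0$. Then there is a feasible solution with buffer capacity $\ell$ whose server travels distance at most $2^\ell$ during each phase; in particular the cost of $\mathrm{OPT}(\ell)$ on this input is at most $2^\ell$ per phase (at most $N\cdot 2^\ell$ in total).
   Context: Reordering buffer problem on a line: requests arrive online at sites of the line (distance $|i-j|$); an algorithm with buffer capacity $s$ has one server and may keep at most $s$ unprocessed requests; whenever $s$ requests are pending it must move the server to a pending request of its choice and serve it (requests at the current server position are served at no cost). Cost = total distance traveled. $\mathrm{OPT}(s)$ is an optimal offline algorithm with buffer $s$. Input construction: sites are numbered $0,\dots,2^\ell$. Requests arrive only in steps, a step being the open time interval between two consecutive integer times; requests within a step arrive in increasing order of site. A phase consists of the $2^\ell$ steps between times $0$ and $2^\ell$. For integers $q\in\{1,\dots,\ell\}$ and $s\in\{0,\dots,2^{\ell-q}-1\}$, the $(q,s)$-block (of rank $q$) consists of all times in $(2^q s,2^q(s+1)]$ and all sites in $(2^q s,2^q(s+1)]$. In each $(q,s)$-block, one regular request of rank $q-1$ arrives at site $2^q(s+1)$ in the step between times $2^q s$ and $2^q s+1$. In addition, for each $j\in\{0,\dots,2^\ell-1\}$, an anchor, i.e. a set of $\ell+1$ requests, arrives at site $j$ in the step between times $j$ and $j+1$. Each subsequent phase is the mirror image of the previous one: it is shifted in time by $2^\ell$ and site $i$ is replaced by site $2^\ell-i$. -}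

module Defs where

open import Data.Nat using (ℕ; zero; suc; _+_; _*_; _∸_; _^_; _≤_; _<_; _≟_; ∣_-_∣)
open import Data.Nat.Divisibility using (_∣?_)
open import Data.Bool using (if_then_else_)
open import Data.List using (List; []; _∷_; _++_; map; filter; replicate; reverse; concat; upTo; length)
open import Data.Nat.ListAction using (sum)
open import Data.List.Membership.Propositional using (_∈_)
open import Data.Product using (_×_; _,_; proj₁; proj₂)
open import Data.Unit using (⊤)
open import Data.Empty using (⊥)
open import Relation.Nullary using (¬?)
open import Relation.Nullary.Decidable using (⌊_⌋)
open import Relation.Binary.PropositionalEquality using (_≡_)

-- The input sequence (sites only; requests are identified by their
-- position in the arrival sequence).

ranks : ℕ → List ℕ
ranks ℓ = map suc (upTo ℓ)

-- Requests of the step between times t and t+1 of the first phase, in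
-- increasing order of site: the anchor (ℓ+1 requests at site t), then
-- for each q with 2^q ∣ t (i.e. t = 2^q s, the (q,s)-block starts) the
-- regular request at site 2^q (s+1) = t + 2^q.
step₀ : ℕ → ℕ → List ℕ
step₀ ℓ t = replicate (suc ℓ) t
         ++ map (λ q → t + 2 ^ q) (filter (λ q → 2 ^ q ∣? t) (ranks ℓ))

phase₀ : ℕ → List (List ℕ)
phase₀ ℓ = map (step₀ ℓ) (upTo (2 ^ ℓ))

-- Mirror image of a step: site i ↦ 2^ℓ - i; the order is reversed so
-- that requests within a step still arrive in increasing order of site.
mirrorStep : ℕ → List ℕ → List ℕ
mirrorStep ℓ xs = reverse (map (λ i → 2 ^ ℓ ∸ i) xs)

phase : ℕ → ℕ → List (List ℕ)
phase ℓ zero    = phase₀ ℓ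
phase ℓ (suc p) = map (mirrorStep ℓ) (phase ℓ p)

input : ℕ → ℕ → List (ℕ × ℕ)
input ℓ N = concat (map (λ p → map (λ x → p , x) (concat (phase ℓ p))) (upTo N))

record Config : Set where
  constructor ⟨_,_⟩
  field
    pos  : ℕ
    pend : List ℕ
open Config public

arrive : ℕ → Config → Config
arrive x c = if ⌊ x ≟ pos c ⌋ then c else ⟨ pos c , x ∷ pend c ⟩

move : ℕ → Config → Config
move y c = ⟨ y , filter (λ z → ¬? (z ≟ y)) (pend c) ⟩

runMoves : Config → List ℕ → Config
runMoves c []       = c
runMoves c (y ∷ ys) = runMoves (move y c) ys

ValidMoves : Config → List ℕ → Set
ValidMoves c []       = ⊤
ValidMoves c (y ∷ ys) = (y ∈ pend c) × ValidMoves (move y c) ys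

movesCost : ℕ → List ℕ → ℕ
movesCost a []       = 0
movesCost a (y ∷ ys) = ∣ a - y ∣ + movesCost y ys

-- A solution for an arrival sequence xs consists of a list of moves
-- performed right after each arrival (ms, one list per request) and a
-- final list of moves fl performed after the input has ended.
Feasible : ℕ → Config → List ℕ → List (List ℕ) → List ℕ → Set
Feasible s c []       []       fl = ValidMoves c fl × pend (runMoves c fl) ≡ []
Feasible s c (x ∷ xs) (m ∷ ms) fl =
  let c' = arrive x c in
  ValidMoves c' m × length (pend (runMoves c' m)) ≤ s
    × Feasible s (runMoves c' m) xs ms fl
Feasible s c []       (_ ∷ _)  fl = ⊥
Feasible s c (_ ∷ _)  []       fl = ⊥

arrivalCosts : ℕ → List (List ℕ) → List ℕ
arrivalCosts a []       = []
arrivalCosts a (m ∷ ms) = movesCost a m ∷ arrivalCosts (pos (runMoves ⟨ a , [] ⟩ m)) ms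

finalPos : ℕ → List (List ℕ) → ℕ
finalPos a []       = a
finalPos a (m ∷ ms) = finalPos (pos (runMoves ⟨ a , [] ⟩ m)) ms

totalCost : ℕ → List (List ℕ) → List ℕ → ℕ
totalCost a ms fl = sum (arrivalCosts a ms) + movesCost (finalPos a ms) fl

-- Distance travelled during phase p: the moves performed after the
-- arrival of a request of phase p (and before the next arrival).
phaseCost : List (ℕ × ℕ) → ℕ → List (List ℕ) → ℕ → ℕ
phaseCost reqs a ms p = go reqs (arrivalCosts a ms)
  where
  go : List (ℕ × ℕ) → List ℕ → ℕ
  go ((p' , _) ∷ rs) (k ∷ ks) = (if ⌊ p' ≟ p ⌋ then k else 0) + go rs ks
  go _ _ = 0

start : Config
start = ⟨ 0 , [] ⟩

-- Read each phase in its own coordinates (mirrored for odd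
-- phases), so that every phase looks like phase 0.  In step t the server
-- moves, right after the first request of the step arrives, to the anchor
-- site t and stays there for the rest of the step.  Invariant at the start
-- of step t: the server is at coordinate t ± 1, and for every rank q
-- exactly one request is pending, at the multiple of 2^q in [t, t + 2^q).
-- So the anchor site is pending when the server moves (the rank-1 request
-- if t is even, the just-arrived anchor if t is odd), exactly ℓ requests
-- wait afterwards, and every step costs one; only step 0 of phase 0 is
-- free.  At the end of a phase all pending requests are at coordinate 2^ℓ,
-- i.e. coordinate 0 of the next phase, and one final move serves them.

module Submission where

open import Defs
open import Data.Nat using (ℕ; zero; suc; _+_; _*_; _∸_; _^_; _≤_; _<_; _≟_; ∣_-_∣; z≤n; s≤s)
open import Data.Nat.Properties
open import Data.Nat.Divisibility using (_∣_; divides; _∣?_; ∣-trans; ∣m∣n⇒∣m+n; ∣-refl; _∣0)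
open import Data.Nat.ListAction using (sum)
open import Data.Nat.ListAction.Properties using (sum-++)
open import Data.Bool using (Bool; true; false; not; if_then_else_)
open import Data.Product using (Σ; _×_; _,_; proj₁; proj₂)
open import Data.Sum using (_⊎_; inj₁; inj₂)
open import Data.Empty using (⊥; ⊥-elim)
open import Data.Unit using (tt)
open import Relation.Nullary using (¬_; Dec; yes; no; ¬?)
open import Relation.Nullary.Decidable using (⌊_⌋)
import Relation.Unary
open import Relation.Binary.PropositionalEquality
open import Data.List
  using (List; []; _∷_; _++_; map; filter; replicate; reverse; concat; upTo; length; _ʳ++_)
import Data.List.Properties as LP
open import Data.List.Relation.Unary.All as All using (All; []; _∷_)
import Data.List.Relation.Unary.All.Properties as AllP
open import Data.List.Relation.Unary.Any using (here; there)
open import Data.List.Membership.Propositional using (_∈_)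
import Data.List.Membership.Propositional.Properties as MP
open import Data.List.Relation.Binary.Permutation.Propositional
  using (_↭_; ↭-refl; ↭-sym; ↭-trans; ↭-reflexive; ↭ₛ⇒↭; module PermutationReasoning)
import Data.List.Relation.Binary.Permutation.Propositional.Properties as PP
import Data.List.Relation.Binary.Permutation.Setoid.Properties as SP

multiple-gap : ∀ {d u a} → d ∣ u → d ∣ a → u < a → u + d ≤ a
multiple-gap {d} (divides i refl) (divides j refl) u<a =
  subst (_≤ j * d) (+-comm d (i * d)) (*-monoˡ-≤ d (*-cancelʳ-< d i j u<a))

multiple-in-window : ∀ {d u a} → d ∣ u → d ∣ a → a ≤ u → u < a + d → u ≡ a
multiple-in-window d∣u d∣a a≤u u<a+d =
  ≤-antisym (≮⇒≥ λ a<u → <⇒≱ u<a+d (multiple-gap d∣a d∣u a<u)) a≤u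

2^-∣ : ∀ {q r} → q ≤ r → 2 ^ q ∣ 2 ^ r
2^-∣ {q} {r} q≤r =
  divides (2 ^ (r ∸ q)) (trans (cong (2 ^_) (sym (m∸n+n≡m q≤r))) (^-distribˡ-+-* 2 (r ∸ q) q))

mirror-∸ : ∀ L u v → u ≤ v → v ≤ L → (L ∸ u) ∸ (L ∸ v) ≡ v ∸ u
mirror-∸ L       zero    v       _         v≤L       = m∸[m∸n]≡n v≤L
mirror-∸ (suc L) (suc u) (suc v) (s≤s u≤v) (s≤s v≤L) = mirror-∸ L u v u≤v v≤L

mirror-distance-≤ : ∀ L {u v} → u ≤ v → v ≤ L → ∣ (L ∸ u) - (L ∸ v) ∣ ≡ ∣ u - v ∣
mirror-distance-≤ L {u} {v} u≤v v≤L = begin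
  ∣ (L ∸ u) - (L ∸ v) ∣ ≡⟨ m≤n⇒∣n-m∣≡n∸m (∸-monoʳ-≤ L u≤v) ⟩
  (L ∸ u) ∸ (L ∸ v)     ≡⟨ mirror-∸ L u v u≤v v≤L ⟩
  v ∸ u                 ≡⟨ sym (m≤n⇒∣m-n∣≡n∸m u≤v) ⟩
  ∣ u - v ∣             ∎
  where open ≡-Reasoning

mirror-distance : ∀ L {u v} → u ≤ L → v ≤ L → ∣ (L ∸ u) - (L ∸ v) ∣ ≡ ∣ u - v ∣
mirror-distance L {u} {v} u≤L v≤L with ≤-total u v
... | inj₁ u≤v = mirror-distance-≤ L u≤v v≤L
... | inj₂ v≤u = trans (∣-∣-comm (L ∸ u) (L ∸ v))
                   (trans (mirror-distance-≤ L v≤u u≤L) (∣-∣-comm v u))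

∣n-1+n∣ : ∀ n → ∣ n - suc n ∣ ≡ 1
∣n-1+n∣ n = trans (cong (∣ n -_∣) (+-comm 1 n)) (∣m-m+n∣≡n n 1)

distance-one : ∀ {u v t} → ∣ u - t ∣ ≡ 1 → (v ≡ t ⊎ t + 2 ≤ v) → ¬ v ≡ u
distance-one {u} d (inj₁ refl) refl with trans (sym (∣n-n∣≡0 u)) d
... | ()
distance-one {u} {_} {t} d (inj₂ t+2≤u) refl =
  <-irrefl refl (+-cancelˡ-≤ t 2 1 (≤-trans t+2≤u (subst (λ k → u ≤ t + k) d (m≤n+∣m-n∣ u t))))

-- Runs compose,
-- which lets the solution be assembled step by step and phase by phase.
Run : ℕ → Config → List ℕ → List (List ℕ) → Config → Set
Run s c []       []       c' = c ≡ c'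
Run s c (x ∷ xs) (m ∷ ms) c' =
  ValidMoves (arrive x c) m × length (pend (runMoves (arrive x c) m)) ≤ s
    × Run s (runMoves (arrive x c) m) xs ms c'
Run s c []       (_ ∷ _)  c' = ⊥
Run s c (_ ∷ _)  []       c' = ⊥

Run-++ : ∀ {s c c' c''} xs ms ys ns → Run s c xs ms c' → Run s c' ys ns c'' →
  Run s c (xs ++ ys) (ms ++ ns) c''
Run-++ []       []       ys ns refl            r' = r'
Run-++ (x ∷ xs) (m ∷ ms) ys ns (v , cap , r) r' = v , cap , Run-++ xs ms ys ns r r'

Run⇒Feasible : ∀ {s c c'} xs ms fl → Run s c xs ms c' → ValidMoves c' fl →
  pend (runMoves c' fl) ≡ [] → Feasible s c xs ms fl
Run⇒Feasible []       []       fl refl            v e = v , e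
Run⇒Feasible (x ∷ xs) (m ∷ ms) fl (v , cap , r) v' e = v , cap , Run⇒Feasible xs ms fl r v' e

-- The server position is determined by the moves alone: Run-finalPos
-- relates the configurations of a run to the positions used by the costs.
pos-arrive : ∀ x c → pos (arrive x c) ≡ pos c
pos-arrive x c with x ≟ pos c
... | yes _ = refl
... | no  _ = refl

pos-runMoves : ∀ {c d} m → pos c ≡ pos d → pos (runMoves c m) ≡ pos (runMoves d m)
pos-runMoves []      e = e
pos-runMoves (y ∷ m) _ = pos-runMoves m refl

Run-finalPos : ∀ {s c c'} xs ms → Run s c xs ms c' → finalPos (pos c) ms ≡ pos c'
Run-finalPos []       []       refl        = refl
Run-finalPos (x ∷ xs) (m ∷ ms) (_ , _ , r) =
  trans (cong (λ a → finalPos a ms) (sym (pos-runMoves m (pos-arrive x _))))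
        (Run-finalPos xs ms r)

unserved : ℕ → List ℕ → List ℕ
unserved y = filter (λ z → ¬? (z ≟ y))

unserved-at : ∀ {y x} xs → x ≡ y → unserved y (x ∷ xs) ≡ unserved y xs
unserved-at {y} xs x≡y = LP.filter-reject (λ z → ¬? (z ≟ y)) (λ x≢y → x≢y x≡y)

unserved-away : ∀ {y x} xs → ¬ x ≡ y → unserved y (x ∷ xs) ≡ x ∷ unserved y xs
unserved-away {y} xs x≢y = LP.filter-accept (λ z → ¬? (z ≟ y)) x≢y

arrive-at : ∀ {x} c → x ≡ pos c → arrive x c ≡ c
arrive-at {x} c x≡a with x ≟ pos c
... | yes _   = refl
... | no  x≢a = ⊥-elim (x≢a x≡a)

arrive-away : ∀ {x} c → ¬ x ≡ pos c → arrive x c ≡ ⟨ pos c , x ∷ pend c ⟩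
arrive-away {x} c x≢a with x ≟ pos c
... | yes x≡a = ⊥-elim (x≢a x≡a)
... | no  _   = refl

stay : ∀ s y P xs → length (unserved y xs) + length P ≤ s →
  Run s ⟨ y , P ⟩ xs (replicate (length xs) []) ⟨ y , unserved y xs ʳ++ P ⟩
stay s y P []       _ = refl
stay s y P (x ∷ xs) h = by-case (x ≟ y)
  where
  by-case : Dec (x ≡ y) →
    Run s ⟨ y , P ⟩ (x ∷ xs) (replicate (length (x ∷ xs)) []) ⟨ y , unserved y (x ∷ xs) ʳ++ P ⟩
  by-case (yes x≡y) rewrite arrive-at ⟨ y , P ⟩ x≡y | unserved-at xs x≡y =
    tt , ≤-trans (m≤n+m (length P) _) h , stay s y P xs h
  by-case (no x≢y) rewrite arrive-away ⟨ y , P ⟩ x≢y | unserved-away xs x≢y =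
    tt , ≤-trans (s≤s (m≤n+m (length P) _)) h , stay s y (x ∷ P) xs (subst (_≤ s) (sym (+-suc _ _)) h)

moveFirst : ℕ → List ℕ → List (List ℕ)
moveFirst y []      = []
moveFirst y (_ ∷ R) = (y ∷ []) ∷ replicate (length R) []

length-moveFirst : ∀ y R → length (moveFirst y R) ≡ length R
length-moveFirst y []      = refl
length-moveFirst y (_ ∷ R) = cong suc (LP.length-replicate (length R))

moveThenStay : ∀ s a P y x R → ¬ x ≡ a → y ∈ x ∷ P →
  length (unserved y R ʳ++ unserved y (x ∷ P)) ≤ s →
  Run s ⟨ a , P ⟩ (x ∷ R) (moveFirst y (x ∷ R)) ⟨ y , unserved y R ʳ++ unserved y (x ∷ P) ⟩
moveThenStay s a P y x R x≢a y∈ h rewrite arrive-away ⟨ a , P ⟩ x≢a =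
  (y∈ , tt) , ≤-trans (m≤n+m _ (length (unserved y R))) h' , stay s y (unserved y (x ∷ P)) R h'
  where
  h' : length (unserved y R) + length (unserved y (x ∷ P)) ≤ s
  h' = subst (_≤ s) (LP.length-ʳ++ (unserved y R)) h

moveThenStay-pending : ∀ y x R P →
  unserved y R ʳ++ unserved y (x ∷ P) ↭ unserved y (x ∷ R) ++ unserved y P
moveThenStay-pending y x R P =
  ↭-trans (↭-sym (PP.++↭ʳ++ (unserved y R) (unserved y (x ∷ P)))) (by-case (x ≟ y))
  where
  by-case : Dec (x ≡ y) → unserved y R ++ unserved y (x ∷ P) ↭ unserved y (x ∷ R) ++ unserved y P
  by-case (yes x≡y) rewrite unserved-at P x≡y | unserved-at R x≡y = ↭-refl
  by-case (no x≢y) rewrite unserved-away P x≢y | unserved-away R x≢y =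
    PP.shift x (unserved y R) (unserved y P)

arrivalCosts-++ : ∀ a ms ns →
  arrivalCosts a (ms ++ ns) ≡ arrivalCosts a ms ++ arrivalCosts (finalPos a ms) ns
arrivalCosts-++ a []       ns = refl
arrivalCosts-++ a (m ∷ ms) ns = cong (movesCost a m ∷_) (arrivalCosts-++ _ ms ns)

sum-arrivalCosts-++ : ∀ a ms ns →
  sum (arrivalCosts a (ms ++ ns)) ≡ sum (arrivalCosts a ms) + sum (arrivalCosts (finalPos a ms) ns)
sum-arrivalCosts-++ a ms ns = trans (cong sum (arrivalCosts-++ a ms ns)) (sum-++ (arrivalCosts a ms) _)

stay-cost : ∀ a k → sum (arrivalCosts a (replicate k [])) ≡ 0
stay-cost a zero    = refl
stay-cost a (suc k) = stay-cost a k

moveFirst-cost : ∀ a y x R → sum (arrivalCosts a (moveFirst y (x ∷ R))) ≡ ∣ a - y ∣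
moveFirst-cost a y x R rewrite stay-cost y (length R) = trans (+-identityʳ _) (+-identityʳ _)

concat-snoc : ∀ {A : Set} (f : ℕ → List A) n →
  concat (map f (upTo (suc n))) ≡ concat (map f (upTo n)) ++ f n
concat-snoc f n = begin
  concat (map f (upTo (suc n)))          ≡⟨ cong (λ l → concat (map f l)) (sym (LP.upTo-∷ʳ n)) ⟩
  concat (map f (upTo n ++ n ∷ []))      ≡⟨ cong concat (LP.map-++ f (upTo n) (n ∷ [])) ⟩
  concat (map f (upTo n) ++ f n ∷ [])    ≡⟨ sym (LP.concat-++ (map f (upTo n)) (f n ∷ [])) ⟩
  concat (map f (upTo n)) ++ (f n ++ []) ≡⟨ cong (concat (map f (upTo n)) ++_) (LP.++-identityʳ (f n)) ⟩
  concat (map f (upTo n)) ++ f n         ∎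
  where open ≡-Reasoning

length-concat-map : ∀ {A B : Set} (f : ℕ → List A) (g : ℕ → List B) →
  (∀ p → length (f p) ≡ length (g p)) → ∀ xs → length (concat (map f xs)) ≡ length (concat (map g xs))
length-concat-map f g eq []       = refl
length-concat-map f g eq (p ∷ xs) =
  trans (LP.length-++ (f p)) (trans (cong₂ _+_ (eq p) (length-concat-map f g eq xs))
                                    (sym (LP.length-++ (g p))))

filter-map-local : ∀ {A B : Set} {P : B → Set} {Q : A → Set}
  (P? : Relation.Unary.Decidable P) (Q? : Relation.Unary.Decidable Q) (f : A → B) {xs} →
  All (λ x → (P (f x) → Q x) × (Q x → P (f x))) xs → filter P? (map f xs) ≡ map f (filter Q? xs)
filter-map-local P? Q? f []                       = refl
filter-map-local P? Q? f {x ∷ xs} ((p⇒q , q⇒p) ∷ agree) with P? (f x) | Q? x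
... | yes _  | yes _  = cong (f x ∷_) (filter-map-local P? Q? f agree)
... | no  _  | no  _  = filter-map-local P? Q? f agree
... | yes p  | no ¬q  = ⊥-elim (¬q (p⇒q p))
... | no ¬p  | yes q  = ⊥-elim (¬p (q⇒p q))

partition-↭ : ∀ {A : Set} {P : A → Set} (P? : Relation.Unary.Decidable P) xs →
  xs ↭ filter P? xs ++ filter (λ x → ¬? (P? x)) xs
partition-↭ {A} P? xs = subst (λ parts → xs ↭ proj₁ parts ++ proj₂ parts) (LP.partition-defn P? xs)
  (↭ₛ⇒↭ (SP.partition-↭ (setoid A) P? xs))

tagged : (ℕ → List ℕ) → List ℕ → List (ℕ × ℕ)
tagged f ps = concat (map (λ p → map (λ x → p , x) (f p)) ps)

untag : ∀ f ps → map proj₂ (tagged f ps) ≡ concat (map f ps)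
untag f []       = refl
untag f (p ∷ ps) = begin
  map proj₂ (map (λ x → p , x) (f p) ++ tagged f ps)
    ≡⟨ LP.map-++ proj₂ (map (λ x → p , x) (f p)) (tagged f ps) ⟩
  map proj₂ (map (λ x → p , x) (f p)) ++ map proj₂ (tagged f ps)
    ≡⟨ cong₂ _++_ (trans (sym (LP.map-∘ (f p))) (LP.map-id (f p))) (untag f ps) ⟩
  f p ++ concat (map f ps) ∎
  where open ≡-Reasoning

phaseCost-++ : ∀ rs ms rs' ms' a p → length rs ≡ length ms →
  phaseCost (rs ++ rs') a (ms ++ ms') p ≡ phaseCost rs a ms p + phaseCost rs' (finalPos a ms) ms' p
phaseCost-++ []              []       rs' ms' a p _ = refl
phaseCost-++ ((p' , x) ∷ rs) (m ∷ ms) rs' ms' a p e =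
  trans (cong (own +_) (phaseCost-++ rs ms rs' ms' _ p (suc-injective e)))
        (sym (+-assoc own _ _))
  where
  own : ℕ
  own = if ⌊ p' ≟ p ⌋ then movesCost a m else 0

phaseCost-foreign : ∀ {p' p} xs a ms → ¬ p' ≡ p → phaseCost (map (λ x → p' , x) xs) a ms p ≡ 0
phaseCost-foreign             []       a ms       _    = refl
phaseCost-foreign             (x ∷ xs) a []       _    = refl
phaseCost-foreign {p'} {p} (x ∷ xs) a (m ∷ ms) p'≢p with p' ≟ p
... | yes p'≡p = ⊥-elim (p'≢p p'≡p)
... | no  _    = phaseCost-foreign xs _ ms p'≢p

phaseCost-own : ∀ {p} xs a ms → length xs ≡ length ms →
  phaseCost (map (λ x → p , x) xs) a ms p ≡ sum (arrivalCosts a ms)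
phaseCost-own         []       a []       _ = refl
phaseCost-own {p} (x ∷ xs) a (m ∷ ms) e with p ≟ p
... | yes _   = cong (movesCost a m +_) (phaseCost-own xs _ ms (suc-injective e))
... | no  p≢p = ⊥-elim (p≢p refl)

module PhaseAccounting (f : ℕ → List ℕ) (g : ℕ → List (List ℕ))
                       (same-length : ∀ p → length (f p) ≡ length (g p)) where

  moves : ℕ → List (List ℕ)
  moves N = concat (map g (upTo N))

  requests-snoc : ∀ N → map proj₂ (tagged f (upTo (suc N))) ≡ map proj₂ (tagged f (upTo N)) ++ f N
  requests-snoc N = begin
    map proj₂ (tagged f (upTo (suc N)))    ≡⟨ untag f (upTo (suc N)) ⟩
    concat (map f (upTo (suc N)))          ≡⟨ concat-snoc f N ⟩
    concat (map f (upTo N)) ++ f N         ≡⟨ cong (_++ f N) (untag f (upTo N)) ⟨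
    map proj₂ (tagged f (upTo N)) ++ f N   ∎
    where open ≡-Reasoning

  cost-snoc : ∀ N → sum (arrivalCosts 0 (moves (suc N)))
    ≡ sum (arrivalCosts 0 (moves N)) + sum (arrivalCosts (finalPos 0 (moves N)) (g N))
  cost-snoc N = trans (cong (λ ms → sum (arrivalCosts 0 ms)) (concat-snoc g N))
                      (sum-arrivalCosts-++ 0 (moves N) (g N))

  phaseCost-split : ∀ N p → phaseCost (tagged f (upTo (suc N))) 0 (moves (suc N)) p
    ≡ phaseCost (tagged f (upTo N)) 0 (moves N) p
      + phaseCost (map (λ x → N , x) (f N)) (finalPos 0 (moves N)) (g N) p
  phaseCost-split N p = trans
    (cong₂ (λ rs ms → phaseCost rs 0 ms p) (concat-snoc (λ p → map (λ x → p , x) (f p)) N) (concat-snoc g N))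
    (phaseCost-++ (tagged f (upTo N)) (moves N) _ (g N) 0 p
      (length-concat-map _ g (λ p → trans (LP.length-map _ (f p)) (same-length p)) (upTo N)))

  phaseCost-future : ∀ N p → N ≤ p → phaseCost (tagged f (upTo N)) 0 (moves N) p ≡ 0
  phaseCost-future zero    p _   = refl
  phaseCost-future (suc N) p N<p = begin
    phaseCost (tagged f (upTo (suc N))) 0 (moves (suc N)) p ≡⟨ phaseCost-split N p ⟩
    phaseCost (tagged f (upTo N)) 0 (moves N) p + _         ≡⟨ cong₂ _+_ (phaseCost-future N p (<⇒≤ N<p))
                                                          (phaseCost-foreign (f N) _ (g N) (<⇒≢ N<p)) ⟩
    0                                                ∎
    where open ≡-Reasoning

  phaseCost-past : ∀ N p → p < N →
    phaseCost (tagged f (upTo N)) 0 (moves N) p ≡ sum (arrivalCosts (finalPos 0 (moves p)) (g p))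
  phaseCost-past (suc N) p p<1+N with p ≟ N
  ... | yes refl = trans (phaseCost-split N N)
                     (cong₂ _+_ (phaseCost-future N N ≤-refl) (phaseCost-own (f N) _ (g N) (same-length N)))
  ... | no  p≢N  = trans (phaseCost-split N p)
                     (trans (cong₂ _+_ (phaseCost-past N p (≤∧≢⇒< (≤-pred p<1+N) p≢N))
                                       (phaseCost-foreign (f N) _ (g N) (λ N≡p → p≢N (sym N≡p))))
                            (+-identityʳ _))

module Strategy (ℓ : ℕ) (1≤ℓ : 1 ≤ ℓ) where

  L : ℕ
  L = 2 ^ ℓ

  L>0 : 0 < L
  L>0 = m^n>0 2 ℓ

  -- Phase coordinates: a phase of orientation false looks like phase 0,
  -- one of orientation true like its mirror image; orient b i is the
  -- site i seen in the coordinates of a phase of orientation b.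
  orient : Bool → ℕ → ℕ
  orient false i = i
  orient true  i = L ∸ i

  orient-involutive : ∀ b {i} → i ≤ L → orient b (orient b i) ≡ i
  orient-involutive false _   = refl
  orient-involutive true  i≤L = m∸[m∸n]≡n i≤L

  orient-≤ : ∀ b {i} → i ≤ L → orient b i ≤ L
  orient-≤ false i≤L = i≤L
  orient-≤ true  {i} _ = m∸n≤m L i

  orient-distance : ∀ b {u v} → u ≤ L → v ≤ L → ∣ orient b u - orient b v ∣ ≡ ∣ u - v ∣
  orient-distance false _   _   = refl
  orient-distance true  u≤L v≤L = mirror-distance L u≤L v≤L

  orient-injective : ∀ b {u v} → u ≤ L → v ≤ L → orient b u ≡ orient b v → u ≡ v
  orient-injective b u≤L v≤L eq =
    trans (sym (orient-involutive b u≤L)) (trans (cong (orient b) eq) (orient-involutive b v≤L))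

  orient-flip : ∀ b {i} → i ≤ L → orient (not b) i ≡ L ∸ orient b i
  orient-flip false _   = refl
  orient-flip true  i≤L = sym (m∸[m∸n]≡n i≤L)

  parity : ℕ → Bool
  parity zero    = false
  parity (suc p) = not (parity p)

  ranks-range : All (λ q → 1 ≤ q × q ≤ ℓ) (ranks ℓ)
  ranks-range = AllP.map⁺ (AllP.applyUpTo⁺₁ (λ i → i) ℓ (λ i<ℓ → s≤s z≤n , i<ℓ))

  1∈ranks : 1 ∈ ranks ℓ
  1∈ranks = first-rank ℓ 1≤ℓ
    where
    first-rank : ∀ n → 1 ≤ n → 1 ∈ ranks n
    first-rank (suc n) _ = here refl

  length-ranks : length (ranks ℓ) ≡ ℓ
  length-ranks = trans (LP.length-map suc (upTo ℓ)) (LP.length-upTo ℓ)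

  starting : ℕ → List ℕ
  starting t = filter (λ q → 2 ^ q ∣? t) (ranks ℓ)

  starting-spec : ∀ t → All (λ q → (1 ≤ q × q ≤ ℓ) × 2 ^ q ∣ t) (starting t)
  starting-spec t = All.zip (AllP.filter⁺ (λ q → 2 ^ q ∣? t) ranks-range ,
                             AllP.all-filter (λ q → 2 ^ q ∣? t) (ranks ℓ))

  starting-odd : ∀ t → ¬ 2 ∣ t → starting t ≡ []
  starting-odd t 2∤t = LP.filter-none (λ q → 2 ^ q ∣? t)
    (All.map (λ (1≤q , _) 2^q∣t → 2∤t (∣-trans (2^-∣ 1≤q) 2^q∣t)) ranks-range)

  regular≤L : ∀ {q t} → q ≤ ℓ → 2 ^ q ∣ t → t < L → t + 2 ^ q ≤ L
  regular≤L q≤ℓ 2^q∣t t<L = multiple-gap 2^q∣t (2^-∣ q≤ℓ) t<L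

  stepReqs : Bool → ℕ → List ℕ
  stepReqs false t = step₀ ℓ t
  stepReqs true  t = mirrorStep ℓ (step₀ ℓ t)

  stepSites : Bool → ℕ → List ℕ
  stepSites b t = replicate (suc ℓ) (orient b t) ++ map (λ q → orient b (t + 2 ^ q)) (starting t)

  stepReqs↭ : ∀ b t → stepReqs b t ↭ stepSites b t
  stepReqs↭ false t = ↭-refl
  stepReqs↭ true  t = ↭-trans (PP.↭-reverse _) (↭-reflexive
    (trans (LP.map-++ (L ∸_) (replicate (suc ℓ) t) (map (λ q → t + 2 ^ q) (starting t)))
           (cong₂ _++_ (LP.map-replicate (L ∸_) (suc ℓ) t) (sym (LP.map-∘ (starting t))))))

  stepSites-spec : ∀ b t → t < L →
    All (λ r → r ≤ L × (orient b r ≡ t ⊎ t + 2 ≤ orient b r)) (stepSites b t)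
  stepSites-spec b t t<L = AllP.++⁺
    (AllP.replicate⁺ (suc ℓ) (orient-≤ b (<⇒≤ t<L) , inj₁ (orient-involutive b (<⇒≤ t<L))))
    (AllP.map⁺ (All.map (λ { {q} ((1≤q , q≤ℓ) , 2^q∣t) →
       let t+2^q≤L = regular≤L q≤ℓ 2^q∣t t<L in
       orient-≤ b t+2^q≤L ,
       inj₂ (subst (t + 2 ≤_) (sym (orient-involutive b t+2^q≤L)) (+-monoʳ-≤ t (^-monoʳ-≤ 2 1≤q))) })
      (starting-spec t)))

  mirror-involutive : ∀ xs → All (_≤ L) xs → mirrorStep ℓ (mirrorStep ℓ xs) ≡ xs
  mirror-involutive xs xs≤L = begin
    reverse (map (L ∸_) (reverse (map (L ∸_) xs))) ≡⟨ cong reverse (LP.reverse-map (L ∸_) (map (L ∸_) xs)) ⟩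
    reverse (reverse (map (L ∸_) (map (L ∸_) xs))) ≡⟨ LP.reverse-involutive _ ⟩
    map (L ∸_) (map (L ∸_) xs)                     ≡⟨ sym (LP.map-∘ xs) ⟩
    map (λ i → L ∸ (L ∸ i)) xs                     ≡⟨ LP.map-id-local (All.map m∸[m∸n]≡n xs≤L) ⟩
    xs                                             ∎
    where open ≡-Reasoning

  stepReqs-mirror : ∀ b t → t < L → mirrorStep ℓ (stepReqs b t) ≡ stepReqs (not b) t
  stepReqs-mirror false t _   = refl
  stepReqs-mirror true  t t<L = mirror-involutive (step₀ ℓ t) (All.map proj₁ (stepSites-spec false t t<L))

  phase-steps : ∀ p → phase ℓ p ≡ map (stepReqs (parity p)) (upTo L)
  phase-steps zero    = refl
  phase-steps (suc p) = begin
    map (mirrorStep ℓ) (phase ℓ p)                          ≡⟨ cong (map (mirrorStep ℓ)) (phase-steps p) ⟩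
    map (mirrorStep ℓ) (map (stepReqs (parity p)) (upTo L)) ≡⟨ sym (LP.map-∘ (upTo L)) ⟩
    map (λ t → mirrorStep ℓ (stepReqs (parity p) t)) (upTo L)
      ≡⟨ LP.map-cong-local (AllP.applyUpTo⁺₁ (λ i → i) L (λ t<L → stepReqs-mirror (parity p) _ t<L)) ⟩
    map (stepReqs (parity (suc p))) (upTo L)                ∎
    where open ≡-Reasoning

  record SlotAt (b : Bool) (t q x : ℕ) : Set where
    constructor slot
    field
      rank≤ℓ     : q ≤ ℓ
      site≤L     : x ≤ L
      aligned    : 2 ^ q ∣ orient b x
      from       : t ≤ orient b x
      below      : orient b x < t + 2 ^ q

  Slot : Bool → ℕ → ℕ × ℕ → Set
  Slot b t (q , x) = SlotAt b t q x

  slot-at-anchor : ∀ {b t q x} → SlotAt b t q x → 2 ^ q ∣ t → x ≡ orient b t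
  slot-at-anchor {b} (slot _ x≤L aligned from below) 2^q∣t =
    trans (sym (orient-involutive b x≤L)) (cong (orient b) (multiple-in-window aligned 2^q∣t from below))

  slot-at-anchor⁻¹ : ∀ {b t q x} → t ≤ L → SlotAt b t q x → x ≡ orient b t → 2 ^ q ∣ t
  slot-at-anchor⁻¹ {b} {t} {q} t≤L s x≡y =
    subst (2 ^ q ∣_) (trans (cong (orient b) x≡y) (orient-involutive b t≤L)) (SlotAt.aligned s)

  record Pending (b : Bool) (t : ℕ) (P : List ℕ) : Set where
    constructor pending
    field
      slots        : List (ℕ × ℕ)
      sites        : P ↭ map proj₂ slots
      one-per-rank : map proj₁ slots ↭ ranks ℓ
      valid        : All (Slot b t) slots

  Pending-↭ : ∀ {b t P Q} → P ↭ Q → Pending b t Q → Pending b t P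
  Pending-↭ P↭Q (pending T sites per-rank valid) = pending T (↭-trans P↭Q sites) per-rank valid

  Pending-length : ∀ {b t P} → Pending b t P → length P ≡ ℓ
  Pending-length {P = P} (pending T sites per-rank _) = begin
    length P               ≡⟨ PP.↭-length sites ⟩
    length (map proj₂ T)   ≡⟨ LP.length-map proj₂ T ⟩
    length T               ≡⟨ sym (LP.length-map proj₁ T) ⟩
    length (map proj₁ T)   ≡⟨ PP.↭-length per-rank ⟩
    length (ranks ℓ)       ≡⟨ length-ranks ⟩
    ℓ                      ∎
    where open ≡-Reasoning

  -- In even steps the rank-1 request waits at the anchor site.
  anchor-pending : ∀ {b t P} → t ≤ L → 2 ∣ t → Pending b t P → orient b t ∈ P
  anchor-pending t≤L 2∣t (pending T sites per-rank valid)
    with MP.∈-map⁻ proj₁ (PP.∈-resp-↭ (↭-sym per-rank) 1∈ranks)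
  ... | (q , x) , e∈T , refl = PP.∈-resp-↭ (↭-sym sites)
    (subst (_∈ map proj₂ T) (slot-at-anchor (All.lookup valid e∈T) 2∣t) (MP.∈-map⁺ proj₂ e∈T))

  renewed : Bool → ℕ → List (ℕ × ℕ)
  renewed b t = map (λ q → q , orient b (t + 2 ^ q)) (starting t)

  kept : ℕ → List (ℕ × ℕ) → List (ℕ × ℕ)
  kept t T = filter (λ e → ¬? (2 ^ proj₁ e ∣? t)) T

  continuing : ℕ → List ℕ
  continuing t = filter (λ q → ¬? (2 ^ q ∣? t)) (ranks ℓ)

  renew-ranks : ∀ b t T → map proj₁ (kept t T) ↭ continuing t →
    map proj₁ (renewed b t ++ kept t T) ↭ ranks ℓ
  renew-ranks b t T kept↭ = begin
    map proj₁ (renewed b t ++ kept t T)             ≡⟨ LP.map-++ proj₁ (renewed b t) (kept t T) ⟩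
    map proj₁ (renewed b t) ++ map proj₁ (kept t T)
      ≡⟨ cong (_++ map proj₁ (kept t T)) (trans (sym (LP.map-∘ (starting t))) (LP.map-id (starting t))) ⟩
    starting t ++ map proj₁ (kept t T)              ↭⟨ PP.++⁺ˡ (starting t) kept↭ ⟩
    starting t ++ continuing t                      ↭⟨ partition-↭ (λ q → 2 ^ q ∣? t) (ranks ℓ) ⟨
    ranks ℓ                                         ∎
    where open PermutationReasoning

  renewed-valid : ∀ b t → t < L → All (Slot b (suc t)) (renewed b t)
  renewed-valid b t t<L = AllP.map⁺ (All.map (λ { {q} ((_ , q≤ℓ) , 2^q∣t) →
    let t+2^q≤L = regular≤L q≤ℓ 2^q∣t t<L
        y≡ = orient-involutive b t+2^q≤L in
    slot q≤ℓ (orient-≤ b t+2^q≤L)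
      (subst (2 ^ q ∣_) (sym y≡) (∣m∣n⇒∣m+n 2^q∣t ∣-refl))
      (subst (suc t ≤_) (sym y≡) (subst (_≤ t + 2 ^ q) (+-comm t 1) (+-monoʳ-≤ t (m^n>0 2 q))))
      (subst (_< suc t + 2 ^ q) (sym y≡) (n<1+n (t + 2 ^ q))) }) (starting-spec t))

  kept-valid : ∀ b t T → All (Slot b t) T → All (Slot b (suc t)) (kept t T)
  kept-valid b t T valid = All.map
    (λ { {q , x} (slot r x≤L aligned from below , 2^q∤t) →
         slot r x≤L aligned (≤∧≢⇒< from (λ t≡ → 2^q∤t (subst (2 ^ q ∣_) (sym t≡) aligned)))
              (m<n⇒m<1+n below) })
    (All.zip (AllP.filter⁺ (λ e → ¬? (2 ^ proj₁ e ∣? t)) valid ,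
              AllP.all-filter (λ e → ¬? (2 ^ proj₁ e ∣? t)) T))

  unserved-stepSites : ∀ b t → t < L → unserved (orient b t) (stepSites b t) ≡ map proj₂ (renewed b t)
  unserved-stepSites b t t<L = begin
    unserved y (replicate (suc ℓ) y ++ regulars)
      ≡⟨ LP.filter-++ (λ z → ¬? (z ≟ y)) (replicate (suc ℓ) y) regulars ⟩
    unserved y (replicate (suc ℓ) y) ++ unserved y regulars
      ≡⟨ cong₂ _++_ (LP.filter-none (λ z → ¬? (z ≟ y)) (AllP.replicate⁺ (suc ℓ) (λ y≢y → y≢y refl)))
                    (LP.filter-all (λ z → ¬? (z ≟ y)) regulars≢y) ⟩
    regulars
      ≡⟨ LP.map-∘ (starting t) ⟩
    map proj₂ (renewed b t) ∎
    where
    open ≡-Reasoning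
    y : ℕ
    y = orient b t
    regulars : List ℕ
    regulars = map (λ q → orient b (t + 2 ^ q)) (starting t)
    regulars≢y : All (λ z → ¬ z ≡ y) regulars
    regulars≢y = AllP.map⁺ (All.map (λ { {q} ((_ , q≤ℓ) , 2^q∣t) eq →
      >⇒≢ (m<m+n t (m^n>0 2 q)) (orient-injective b (regular≤L q≤ℓ 2^q∣t t<L) (<⇒≤ t<L) eq) })
      (starting-spec t))

  unserved-slots : ∀ b t T → t ≤ L → All (Slot b t) T →
    unserved (orient b t) (map proj₂ T) ≡ map proj₂ (kept t T)
  unserved-slots b t T t≤L valid =
    filter-map-local (λ z → ¬? (z ≟ orient b t)) (λ e → ¬? (2 ^ proj₁ e ∣? t)) proj₂
    (All.map (λ s → (λ x≢y 2^q∣t → x≢y (slot-at-anchor s 2^q∣t)) ,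
                    (λ 2^q∤t x≡y → 2^q∤t (slot-at-anchor⁻¹ t≤L s x≡y))) valid)

  renew : ∀ b t T → t < L → All (Slot b t) T → map proj₁ (kept t T) ↭ continuing t →
    Pending b (suc t) (unserved (orient b t) (stepSites b t) ++ unserved (orient b t) (map proj₂ T))
  renew b t T t<L valid kept↭ =
    pending (renewed b t ++ kept t T) (↭-reflexive sites) (renew-ranks b t T kept↭)
            (AllP.++⁺ (renewed-valid b t t<L) (kept-valid b t T valid))
    where
    sites : unserved (orient b t) (stepSites b t) ++ unserved (orient b t) (map proj₂ T)
          ≡ map proj₂ (renewed b t ++ kept t T)
    sites = trans (cong₂ _++_ (unserved-stepSites b t t<L) (unserved-slots b t T (<⇒≤ t<L) valid))
                  (sym (LP.map-++ proj₂ (renewed b t) (kept t T)))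

  Pending-step : ∀ b t P → t < L → Pending b t P →
    Pending b (suc t) (unserved (orient b t) (stepSites b t) ++ unserved (orient b t) P)
  Pending-step b t P t<L (pending T sites per-rank valid) =
    Pending-↭ (PP.++⁺ˡ _ (PP.filter-↭ (λ z → ¬? (z ≟ orient b t)) sites)) (renew b t T t<L valid kept↭)
    where
    kept↭ : map proj₁ (kept t T) ↭ continuing t
    kept↭ = ↭-trans
      (↭-reflexive (sym (filter-map-local (λ q → ¬? (2 ^ q ∣? t)) (λ e → ¬? (2 ^ proj₁ e ∣? t)) proj₁
                                          (All.universal (λ _ → (λ p → p) , (λ p → p)) T))))
      (PP.filter-↭ (λ q → ¬? (2 ^ q ∣? t)) per-rank)

  record Inv (b : Bool) (t : ℕ) (c : Config) : Set where
    constructor invariant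
    field
      server≤L : pos c ≤ L
      adjacent : ∣ orient b (pos c) - t ∣ ≡ 1
      waiting  : Pending b t (pend c)

  adjacent-distance : ∀ {b t c} → t ≤ L → Inv b t c → ∣ pos c - orient b t ∣ ≡ 1
  adjacent-distance {b} {t} {c} t≤L (invariant a≤L adjacent _) = begin
    ∣ pos c - orient b t ∣                       ≡⟨ orient-distance b a≤L (orient-≤ b t≤L) ⟨
    ∣ orient b (pos c) - orient b (orient b t) ∣ ≡⟨ cong (∣ orient b (pos c) -_∣) (orient-involutive b t≤L) ⟩
    ∣ orient b (pos c) - t ∣                     ≡⟨ adjacent ⟩
    1                                            ∎
    where open ≡-Reasoning

  odd-step : ∀ b t → ¬ 2 ∣ t → All (_≡ orient b t) (stepSites b t)
  odd-step b t 2∤t rewrite starting-odd t 2∤t =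
    AllP.++⁺ (AllP.replicate⁺ (suc ℓ) refl) []

  step : ∀ b t c → t < L → Inv b t c → Σ Config λ c' →
    Run ℓ c (stepReqs b t) (moveFirst (orient b t) (stepReqs b t)) c' × Inv b (suc t) c'
      × sum (arrivalCosts (pos c) (moveFirst (orient b t) (stepReqs b t))) ≡ 1
  step b t c t<L inv@(invariant a≤L adjacent waiting) = step-with (stepReqs b t) (stepReqs↭ b t)
    where
    y : ℕ
    y = orient b t
    t≤L : t ≤ L
    t≤L = <⇒≤ t<L
    step-with : ∀ R → R ↭ stepSites b t → Σ Config λ c' → Run ℓ c R (moveFirst y R) c' × Inv b (suc t) c'
      × sum (arrivalCosts (pos c) (moveFirst y R)) ≡ 1
    step-with []      R↭ with PP.↭-length R↭
    ... | ()
    step-with (x ∷ R) R↭ =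
      ⟨ y , after ⟩ , moveThenStay ℓ (pos c) (pend c) y x R x≢a y∈ (≤-reflexive (Pending-length waiting')) ,
      invariant (orient-≤ b t≤L) (trans (cong (λ u → ∣ u - suc t ∣) (orient-involutive b t≤L)) (∣n-1+n∣ t))
                waiting' ,
      trans (moveFirst-cost (pos c) y x R) (adjacent-distance t≤L inv)
      where
      after : List ℕ
      after = unserved y R ʳ++ unserved y (x ∷ pend c)
      waiting' : Pending b (suc t) after
      waiting' = Pending-↭ (↭-trans (moveThenStay-pending y x R (pend c))
                                    (PP.++⁺ʳ _ (PP.filter-↭ (λ z → ¬? (z ≟ y)) R↭)))
                           (Pending-step b t (pend c) t<L waiting)
      x≢a : ¬ x ≡ pos c
      x≢a x≡a with PP.All-resp-↭ (↭-sym R↭) (stepSites-spec b t t<L)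
      ... | (_ , x-spec) ∷ _ = distance-one adjacent x-spec (cong (orient b) x≡a)
      y∈ : y ∈ x ∷ pend c
      y∈ with 2 ∣? t
      ... | yes 2∣t = there (anchor-pending t≤L 2∣t waiting)
      ... | no  2∤t with PP.All-resp-↭ (↭-sym R↭) (odd-step b t 2∤t)
      ...   | x≡y ∷ _ = here (sym x≡y)

  stepsReqs : Bool → ℕ → List ℕ
  stepsReqs b n = concat (map (stepReqs b) (upTo n))

  stepsMoves : (ℕ → List (List ℕ)) → ℕ → List (List ℕ)
  stepsMoves sm n = concat (map sm (upTo n))

  Reached : Bool → (ℕ → List (List ℕ)) → Config → ℕ → ℕ → Set
  Reached b sm c₀ k n = Σ Config λ c → Run ℓ c₀ (stepsReqs b n) (stepsMoves sm n) c × Inv b n c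
    × sum (arrivalCosts (pos c₀) (stepsMoves sm n)) + k ≡ n

  extend : ∀ b sm c₀ k n → n < L → sm n ≡ moveFirst (orient b n) (stepReqs b n) →
    Reached b sm c₀ k n → Reached b sm c₀ k (suc n)
  extend b sm c₀ k n n<L sm-n (c , run , inv , cost) with step b n c n<L inv
  ... | c' , run-n , inv' , cost-n = c' , run' , inv' , cost'
    where
    run' : Run ℓ c₀ (stepsReqs b (suc n)) (stepsMoves sm (suc n)) c'
    run' = subst₂ (λ xs ms → Run ℓ c₀ xs ms c') (sym (concat-snoc (stepReqs b) n)) (sym (concat-snoc sm n))
      (Run-++ (stepsReqs b n) (stepsMoves sm n) (stepReqs b n) (sm n) run
        (subst (λ m → Run ℓ c (stepReqs b n) m c') (sym sm-n) run-n))
    before : ℕ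
    before = sum (arrivalCosts (pos c₀) (stepsMoves sm n))
    cost' : sum (arrivalCosts (pos c₀) (stepsMoves sm (suc n))) + k ≡ suc n
    cost' = begin
      sum (arrivalCosts (pos c₀) (stepsMoves sm (suc n))) + k
        ≡⟨ cong (λ ms → sum (arrivalCosts (pos c₀) ms) + k) (concat-snoc sm n) ⟩
      sum (arrivalCosts (pos c₀) (stepsMoves sm n ++ sm n)) + k
        ≡⟨ cong (_+ k) (sum-arrivalCosts-++ (pos c₀) (stepsMoves sm n) (sm n)) ⟩
      before + sum (arrivalCosts (finalPos (pos c₀) (stepsMoves sm n)) (sm n)) + k
        ≡⟨ cong₂ (λ a ms → before + sum (arrivalCosts a ms) + k) (Run-finalPos _ _ run) sm-n ⟩
      before + sum (arrivalCosts (pos c) (moveFirst (orient b n) (stepReqs b n))) + k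
        ≡⟨ cong (λ s → before + s + k) cost-n ⟩
      before + 1 + k
        ≡⟨ cong (_+ k) (+-comm before 1) ⟩
      suc (before + k)
        ≡⟨ cong suc cost ⟩
      suc n ∎
      where open ≡-Reasoning

  iterate : ∀ b sm c₀ k t₀ → (∀ t → t₀ ≤ t → t < L → sm t ≡ moveFirst (orient b t) (stepReqs b t)) →
    Reached b sm c₀ k t₀ → ∀ d → t₀ + d ≤ L → Reached b sm c₀ k (t₀ + d)
  iterate b sm c₀ k t₀ follows r zero    _ = subst (Reached b sm c₀ k) (sym (+-identityʳ t₀)) r
  iterate b sm c₀ k t₀ follows r (suc d) t₀+d<L =
    subst (Reached b sm c₀ k) (sym (+-suc t₀ d))
      (extend b sm c₀ k (t₀ + d) t<L (follows (t₀ + d) (m≤m+n t₀ d) t<L)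
        (iterate b sm c₀ k t₀ follows r d (<⇒≤ t<L)))
    where
    t<L : t₀ + d < L
    t<L = subst (_≤ L) (+-suc t₀ d) t₀+d<L

  -- The moves of the strategy in step t of phase p; only in step 0 of
  -- phase 0 the server is already at the anchor site and does not move.
  strategyMoves : ℕ → ℕ → List (List ℕ)
  strategyMoves zero    zero    = replicate (length (stepReqs false 0)) []
  strategyMoves zero    (suc t) = moveFirst (orient false (suc t)) (stepReqs false (suc t))
  strategyMoves (suc p) t       = moveFirst (orient (parity (suc p)) t) (stepReqs (parity (suc p)) t)

  phaseMoves : ℕ → List (List ℕ)
  phaseMoves p = stepsMoves (strategyMoves p) L

  first-step : Reached false (strategyMoves 0) start 1 1
  first-step = ⟨ 0 , after ⟩ , run , invariant z≤n refl waiting , cost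
    where
    R : List ℕ
    R = stepReqs false 0
    after : List ℕ
    after = unserved 0 R ʳ++ []
    waiting : Pending false 1 after
    waiting = Pending-↭ (↭-sym (PP.++↭ʳ++ (unserved 0 R) []))
      (renew false 0 [] L>0 [] (↭-reflexive (sym (LP.filter-none (λ q → ¬? (2 ^ q ∣? 0))
                                  (All.universal (λ q 2^q∤0 → 2^q∤0 ((2 ^ q) ∣0)) (ranks ℓ))))))
    run : Run ℓ start (stepsReqs false 1) (stepsMoves (strategyMoves 0) 1) ⟨ 0 , after ⟩
    run = subst₂ (λ xs ms → Run ℓ start xs ms ⟨ 0 , after ⟩)
      (sym (LP.++-identityʳ R)) (sym (LP.++-identityʳ (strategyMoves 0 0)))
      (stay ℓ 0 [] R (≤-reflexive (trans (sym (LP.length-ʳ++ (unserved 0 R))) (Pending-length waiting))))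
    cost : sum (arrivalCosts 0 (stepsMoves (strategyMoves 0) 1)) + 1 ≡ 1
    cost = trans (cong (λ ms → sum (arrivalCosts 0 ms) + 1) (LP.++-identityʳ (strategyMoves 0 0)))
                 (cong (_+ 1) (stay-cost 0 (length R)))

  -- Phase 0 costs 2^ℓ - 1; every later phase costs 2^ℓ.
  first-phase : Reached false (strategyMoves 0) start 1 L
  first-phase = subst (Reached false (strategyMoves 0) start 1) (m+[n∸m]≡n L>0)
    (iterate false (strategyMoves 0) start 1 1 follows first-step (L ∸ 1) (≤-reflexive (m+[n∸m]≡n L>0)))
    where
    follows : ∀ t → 1 ≤ t → t < L → strategyMoves 0 t ≡ moveFirst (orient false t) (stepReqs false t)
    follows (suc t) _ _ = refl

  later-phase : ∀ p c → Inv (parity (suc p)) 0 c → Reached (parity (suc p)) (strategyMoves (suc p)) c 0 L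
  later-phase p c inv =
    iterate (parity (suc p)) (strategyMoves (suc p)) c 0 0 (λ _ _ _ → refl) (c , refl , inv , refl) L ≤-refl

  -- At the end of a phase every slot is at phase coordinate L, which is
  -- coordinate 0 of the next, mirrored phase.
  slot-at-end : ∀ {b q x} → SlotAt b L q x → orient b x ≡ L
  slot-at-end (slot q≤ℓ _ aligned from below) = multiple-in-window aligned (2^-∣ q≤ℓ) from below

  turn : ∀ b c → Inv b L c → Inv (not b) 0 c
  turn b c (invariant a≤L adjacent (pending T sites per-rank valid)) =
    invariant a≤L adjacent' (pending T sites per-rank (All.map turn-slot valid))
    where
    adjacent' : ∣ orient (not b) (pos c) - 0 ∣ ≡ 1
    adjacent' = begin
      ∣ orient (not b) (pos c) - 0 ∣ ≡⟨ ∣-∣-identityʳ _ ⟩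
      orient (not b) (pos c)         ≡⟨ orient-flip b a≤L ⟩
      L ∸ orient b (pos c)           ≡⟨ m≤n⇒∣m-n∣≡n∸m (orient-≤ b a≤L) ⟨
      ∣ orient b (pos c) - L ∣       ≡⟨ adjacent ⟩
      1                              ∎
      where open ≡-Reasoning
    turn-slot : ∀ {e} → Slot b L e → Slot (not b) 0 e
    turn-slot {q , x} s@(slot r x≤L _ _ _) = slot r x≤L (subst (2 ^ q ∣_) (sym at-0) (_ ∣0)) z≤n
      (subst (_< 2 ^ q) (sym at-0) (m^n>0 2 q))
      where
      at-0 : orient (not b) x ≡ 0
      at-0 = trans (orient-flip b x≤L) (trans (cong (L ∸_) (slot-at-end s)) (n∸n≡0 L))

  finish : ∀ b c → Inv b L c →
    ValidMoves c (orient b L ∷ []) × pend (runMoves c (orient b L ∷ [])) ≡ [] × ∣ pos c - orient b L ∣ ≡ 1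
  finish b c inv@(invariant _ _ waiting@(pending T sites _ valid)) =
    (anchor-pending ≤-refl (2^-∣ 1≤ℓ) waiting , tt) ,
    PP.↭-empty-inv (↭-trans (PP.filter-↭ (λ z → ¬? (z ≟ y)) sites) (↭-reflexive none-left)) ,
    adjacent-distance ≤-refl inv
    where
    y : ℕ
    y = orient b L
    none-left : unserved y (map proj₂ T) ≡ []
    none-left = LP.filter-none (λ z → ¬? (z ≟ y)) (AllP.map⁺ (All.map
      (λ { {q , x} s y≢x →
           y≢x (trans (sym (orient-involutive b (SlotAt.site≤L s))) (cong (orient b) (slot-at-end s))) })
      valid))

  phase-length : ∀ p → length (concat (phase ℓ p)) ≡ length (phaseMoves p)
  phase-length p = trans (cong (λ steps → length (concat steps)) (phase-steps p))
    (length-concat-map (stepReqs (parity p)) (strategyMoves p) (step-length p) (upTo L))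
    where
    step-length : ∀ p t → length (stepReqs (parity p) t) ≡ length (strategyMoves p t)
    step-length zero    zero    = sym (LP.length-replicate _)
    step-length zero    (suc t) = sym (length-moveFirst (orient false (suc t)) (stepReqs false (suc t)))
    step-length (suc p) t       =
      sym (length-moveFirst (orient (parity (suc p)) t) (stepReqs (parity (suc p)) t))

  open PhaseAccounting (λ p → concat (phase ℓ p)) phaseMoves phase-length public

  record Prefix (N : ℕ) : Set where
    constructor prefix
    field
      config    : Config
      run       : Run ℓ start (map proj₂ (input ℓ (suc N))) (moves (suc N)) config
      inv       : Inv (parity N) L config
      total     : sum (arrivalCosts 0 (moves (suc N))) + 1 ≡ suc N * L
      per-phase : ∀ p → p < suc N → sum (arrivalCosts (finalPos 0 (moves p)) (phaseMoves p)) ≤ L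

  first-prefix : Prefix 0
  first-prefix with first-phase
  ... | c , run , inv , cost = prefix c run' inv total per-phase
    where
    run' : Run ℓ start (map proj₂ (input ℓ 1)) (moves 1) c
    run' = subst₂ (λ xs ms → Run ℓ start xs ms c)
                  (sym (requests-snoc 0)) (sym (LP.++-identityʳ (phaseMoves 0))) run
    total : sum (arrivalCosts 0 (moves 1)) + 1 ≡ 1 * L
    total = trans (cong (λ ms → sum (arrivalCosts 0 ms) + 1) (LP.++-identityʳ (phaseMoves 0)))
                  (trans cost (sym (+-identityʳ L)))
    per-phase : ∀ p → p < 1 → sum (arrivalCosts (finalPos 0 (moves p)) (phaseMoves p)) ≤ L
    per-phase zero    _         = subst (sum (arrivalCosts 0 (phaseMoves 0)) ≤_) cost (m≤m+n _ 1)
    per-phase (suc p) (s≤s ())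

  next-prefix : ∀ N → Prefix N → Prefix (suc N)
  next-prefix N (prefix c run inv total per-phase) with later-phase N c (turn (parity N) c inv)
  ... | c' , run-N , inv' , cost-N = prefix c' run' inv' total' per-phase'
    where
    run' : Run ℓ start (map proj₂ (input ℓ (suc (suc N)))) (moves (suc (suc N))) c'
    run' = subst₂ (λ xs ms → Run ℓ start xs ms c')
      (sym (trans (requests-snoc (suc N)) (cong (λ steps → map proj₂ (input ℓ (suc N)) ++ concat steps)
                                                (phase-steps (suc N)))))
      (sym (concat-snoc phaseMoves (suc N)))
      (Run-++ _ _ _ _ run run-N)
    cost-N' : sum (arrivalCosts (finalPos 0 (moves (suc N))) (phaseMoves (suc N))) ≡ L
    cost-N' = trans (cong (λ a → sum (arrivalCosts a (phaseMoves (suc N)))) (Run-finalPos _ _ run))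
                    (trans (sym (+-identityʳ _)) cost-N)
    before : ℕ
    before = sum (arrivalCosts 0 (moves (suc N)))
    total' : sum (arrivalCosts 0 (moves (suc (suc N)))) + 1 ≡ suc (suc N) * L
    total' = begin
      sum (arrivalCosts 0 (moves (suc (suc N)))) + 1
        ≡⟨ cong (_+ 1) (trans (cost-snoc (suc N)) (cong (before +_) cost-N')) ⟩
      before + L + 1                                 ≡⟨ +-assoc before L 1 ⟩
      before + (L + 1)                               ≡⟨ cong (before +_) (+-comm L 1) ⟩
      before + (1 + L)                               ≡⟨ +-assoc before 1 L ⟨
      before + 1 + L                                 ≡⟨ cong (_+ L) total ⟩
      suc N * L + L                                  ≡⟨ +-comm (suc N * L) L ⟩
      suc (suc N) * L                                ∎
      where open ≡-Reasoning
    per-phase' : ∀ p → p < suc (suc N) → sum (arrivalCosts (finalPos 0 (moves p)) (phaseMoves p)) ≤ L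
    per-phase' p p<2+N with p ≟ suc N
    ... | yes refl = ≤-reflexive cost-N'
    ... | no  p≢N  = per-phase p (≤∧≢⇒< (≤-pred p<2+N) p≢N)

  prefixes : ∀ N → Prefix N
  prefixes zero    = first-prefix
  prefixes (suc N) = next-prefix N (prefixes N)

lemma3 : (ℓ N : ℕ) → 1 ≤ ℓ → 1 ≤ N →
    Σ (List (List ℕ)) λ ms → Σ (List ℕ) λ fl →
    Feasible ℓ start (map proj₂ (input ℓ N)) ms fl
    × (∀ p → p < N → phaseCost (input ℓ N) 0 ms p ≤ 2 ^ ℓ)
    × totalCost 0 ms fl ≤ N * 2 ^ ℓ
lemma3 ℓ (suc N) 1≤ℓ _ =
  moves (suc N) , final-move , feasible , phase-bound , ≤-reflexive total-cost
  where
  open Strategy ℓ 1≤ℓ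
  open Prefix (prefixes N)
  final-move : List ℕ
  final-move = orient (parity N) L ∷ []
  final : ValidMoves config final-move × pend (runMoves config final-move) ≡ []
          × ∣ pos config - orient (parity N) L ∣ ≡ 1
  final = finish (parity N) config inv
  feasible : Feasible ℓ start (map proj₂ (input ℓ (suc N))) (moves (suc N)) final-move
  feasible = Run⇒Feasible _ _ final-move run (proj₁ final) (proj₁ (proj₂ final))
  phase-bound : ∀ p → p < suc N → phaseCost (input ℓ (suc N)) 0 (moves (suc N)) p ≤ L
  phase-bound p p<N = subst (_≤ L) (sym (phaseCost-past (suc N) p p<N)) (per-phase p p<N)
  total-cost : totalCost 0 (moves (suc N)) final-move ≡ suc N * L
  total-cost = begin
    before + (∣ finalPos 0 (moves (suc N)) - orient (parity N) L ∣ + 0)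
      ≡⟨ cong (λ a → before + (∣ a - orient (parity N) L ∣ + 0)) (Run-finalPos _ _ run) ⟩
    before + (∣ pos config - orient (parity N) L ∣ + 0)
      ≡⟨ cong (λ d → before + (d + 0)) (proj₂ (proj₂ final)) ⟩
    before + 1
      ≡⟨ total ⟩
    suc N * L ∎
    where
    open ≡-Reasoning
    before : ℕ
    before = sum (arrivalCosts 0 (moves (suc N)))
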